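{- Let $H$ be a $k$-uniform hypergraph, and let $e\in E(H)$ be an edge containing at least two core vertices. If $\lambda$ is an eigenvalue of $\mathcal{A}_{H-e}$, then $\lambda$ is an eigenvalue of $\mathcal{A}_H$.
   Context: A $k$-uniform hypergraph $H$ ($k\geqslant2$) has a finite vertex set $V(H)$ and an edge set $E(H)$ of $k$-element subsets of $V(H)$. A core vertex is a vertex of degree one (contained in exactly one edge). For an edge $e$ containing core vertices, $H-e$ is the $k$-uniform hypergraph with vertex set $V(H)$ minus the core vertices of $e$, and edge set $E(H)\setminus\{e\}$. The adjacency tensor $\mathcal{A}_H$ of a $k$-uniform hypergraph on $n$ vertices is the order $k$ dimension $n$ tensor with entries $\frac{1}{(k-1)!}$ at $(i_1,\ldots,i_k)$ if $\{i_1,\ldots,i_k\}\in E(H)$ and $0$ otherwise. For $x\in\mathbb{C}^n$, $(\mathcal{A}_Hx)_i=\sum_{i_2,\ldots,i_k}a_{ii_2\cdots i_k}x_{i_2}\cdots x_{i_k}$; $\lambda\in\mathbb{C}$ is an eigenvalue if $\mathcal{A}_Hx=\lambda x^{[k-1]}$ for some nonzero $x$, where $x^{[k-1]}=(x_1^{k-1},\ldots,x_n^{k-1})^\top$. -}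

module Defs where

open import Level using (Level)
open import Data.Nat using (ℕ; zero; suc; _∸_)
open import Data.Bool using (Bool; true; false; if_then_else_; _∧_; not)
open import Data.Fin using (Fin)
open import Data.Fin.Subset using (Subset; _∈_; _⊆_; ∣_∣)
open import Data.Vec using (lookup; tabulate)
open import Data.List using (List; []; _∷_)
open import Data.List.Relation.Unary.All using (All)
open import Data.List.Relation.Unary.Unique.Propositional using (Unique)
open import Data.Product using (Σ; _×_; ∃)
open import Relation.Nullary using (¬_; does)
open import Relation.Binary.PropositionalEquality using (_≡_)
open import Algebra.Bundles using (CommutativeRing)
import Data.Fin as Fin
import Data.Nat as Nat
import Data.Vec.Properties as VecP
import Data.Bool as Bool

record Hypergraph (n : ℕ) : Set where
  constructor mkHypergraph
  field
    V : Subset n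
    E : List (Subset n)
open Hypergraph public

IsUniform : ∀ {n} → ℕ → Hypergraph n → Set
IsUniform k H = Unique (E H) × All (λ e → ∣ e ∣ ≡ k) (E H) × All (λ e → e ⊆ V H) (E H)

degreeIn : ∀ {n} → List (Subset n) → Fin n → ℕ
degreeIn [] v = 0
degreeIn (f ∷ es) v = (if lookup f v then 1 else 0) Nat.+ degreeIn es v

degree : ∀ {n} → Hypergraph n → Fin n → ℕ
degree H v = degreeIn (E H) v

IsCore : ∀ {n} → Hypergraph n → Fin n → Set
IsCore H v = v ∈ V H × degree H v ≡ 1

isCoreᵇ : ∀ {n} → Hypergraph n → Fin n → Bool
isCoreᵇ H v = lookup (V H) v ∧ does (degree H v Nat.≟ 1)

_─_ : ∀ {n} → Hypergraph n → Subset n → Hypergraph n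
_─_ {n} H e = mkHypergraph V' E'
  where
  V' : Subset n
  V' = tabulate (λ i → lookup (V H) i ∧ not (lookup e i ∧ isCoreᵇ H i))
  removeEdge : List (Subset n) → List (Subset n)
  removeEdge [] = []
  removeEdge (f ∷ fs) =
    if does (VecP.≡-dec Bool._≟_ f e) then removeEdge fs else f ∷ removeEdge fs
  E' : List (Subset n)
  E' = removeEdge (E H)

module _ {c ℓ : Level} (R : CommutativeRing c ℓ) where
  open CommutativeRing R renaming (Carrier to C)

  pow : C → ℕ → C
  pow x zero = 1#
  pow x (suc m) = x * pow x m

  prodFin : ∀ {m} → (Fin m → C) → C
  prodFin {zero} g = 1#
  prodFin {suc m} g = g Fin.zero * prodFin (λ j → g (Fin.suc j))

  monomialWithout : ∀ {n} → Subset n → Fin n → (Fin n → C) → C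
  monomialWithout f i x =
    prodFin (λ j → if lookup f j ∧ not (does (j Fin.≟ i)) then x j else 1#)

  -- (𝒜_H x)_i = Σ_{i2..ik} a_{i i2..ik} x_{i2}⋯x_{ik}
  --           = Σ_{f ∈ E(H), i ∈ f} ∏_{j ∈ f∖{i}} x_j
  -- (the (k-1)! orderings of f∖{i} each carry weight 1/(k-1)!)
  adjApplyIn : ∀ {n} → List (Subset n) → (Fin n → C) → Fin n → C
  adjApplyIn [] x i = 0#
  adjApplyIn (f ∷ fs) x i =
    (if lookup f i then monomialWithout f i x else 0#) + adjApplyIn fs x i

  adjApply : ∀ {n} → Hypergraph n → (Fin n → C) → Fin n → C
  adjApply H = adjApplyIn (E H)

  -- λ is an eigenvalue of 𝒜_H (H k-uniform): ∃ nonzero x ∈ C^{V(H)} with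
  -- 𝒜_H x = λ x^{[k-1]}. Vectors on V(H) are functions Fin n → C whose
  -- values outside V(H) are ignored.
  IsEigenvalue : ∀ {n} → ℕ → Hypergraph n → C → Set (c Level.⊔ ℓ)
  IsEigenvalue {n} k H λ' =
    Σ (Fin n → C) λ x →
      (∃ λ i → i ∈ V H × ¬ (x i ≈ 0#)) ×
      (∀ i → i ∈ V H → adjApply H x i ≈ λ' * pow (x i) (k ∸ 1))

module Submission where

-- Let x be an eigenvector y of H − e extended by zero on the removed vertices
-- (the core vertices of e).  Every edge f ≠ e of H avoids those vertices, since they have
-- degree one, so f contributes the same to (𝒜_H x)_i as to (𝒜_{H−e} y)_i.  The
-- edge e contributes nothing: e ∖ {i} still contains one of the two core vertices,
-- where x vanishes.  At a removed vertex i both sides of the eigenequation are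
-- therefore 0, the right-hand side because λ · 0^(k−1) = 0 when k ≥ 2.
-- Uniformity plays no further role.

open import Defs
open import Level using (Level)
open import Data.Nat using (ℕ; _≥_; _<_; _∸_; zero; suc; _≟_)
open import Data.Nat.Properties using (suc-injective; m<n⇒0<n∸m)
open import Data.Fin using (Fin)
open import Data.Fin.Subset using (Subset; _∈_)
open import Data.List using (List; []; _∷_)
open import Data.List.Membership.Propositional using () renaming (_∈_ to _∈ₗ_)
open import Data.List.Relation.Unary.Any using (here; there)
open import Data.Bool using (Bool; true; false; if_then_else_; _∧_; not)
open import Data.Empty using (⊥-elim)
open import Data.Product using (_×_; ∃₂; _,_)
open import Data.Vec using (lookup)
open import Data.Vec.Properties using (lookup∘tabulate; []=⇒lookup; lookup⇒[]=; ≡-dec)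
open import Function using (_∘_)
open import Relation.Nullary using (¬_; Dec; does; yes; no)
open import Relation.Binary.PropositionalEquality using (_≡_; _≢_; refl; sym; trans; cong)
open import Algebra.Bundles using (CommutativeRing)
import Data.Bool as Bool
import Data.Fin as Fin
import Relation.Binary.Reasoning.Setoid as SetoidReasoning

∧≡true⇒ˡ : ∀ {a b} → a ∧ b ≡ true → a ≡ true
∧≡true⇒ˡ {true} _ = refl

∧≡true⇒ʳ : ∀ {a b} → a ∧ b ≡ true → b ≡ true
∧≡true⇒ʳ {true} p = p

∧-not≡true⁻ : ∀ {a b} → a ∧ not b ≡ true → b ≡ false
∧-not≡true⁻ {true} {false} _ = refl

∧-not≡true⁺ : ∀ {a b} → a ≡ true → b ≡ false → a ∧ not b ≡ true
∧-not≡true⁺ refl refl = refl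

does≡true⇒ : ∀ {p} {P : Set p} (d : Dec P) → does d ≡ true → P
does≡true⇒ (yes p) _ = p

∈⇒lookup : ∀ {n} {i : Fin n} {s : Subset n} → i ∈ s → lookup s i ≡ true
∈⇒lookup = []=⇒lookup

lookup⇒∈ : ∀ {n} {i : Fin n} {s : Subset n} → lookup s i ≡ true → i ∈ s
lookup⇒∈ = lookup⇒[]= _ _

removeEdge : ∀ {n} → Subset n → List (Subset n) → List (Subset n)
removeEdge e [] = []
removeEdge e (f ∷ fs) =
  if does (≡-dec Bool._≟_ f e) then removeEdge e fs else f ∷ removeEdge e fs

removeEdge-unique : ∀ {n} (e : Subset n) (r : List (Subset n) → List (Subset n)) →
  r [] ≡ [] →
  (∀ f fs → r (f ∷ fs) ≡ (if does (≡-dec Bool._≟_ f e) then r fs else f ∷ r fs)) →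
  ∀ l → r l ≡ removeEdge e l
removeEdge-unique e r r[] r∷ [] = r[]
removeEdge-unique e r r[] r∷ (f ∷ fs) rewrite r∷ f fs with does (≡-dec Bool._≟_ f e)
... | true = removeEdge-unique e r r[] r∷ fs
... | false = cong (f ∷_) (removeEdge-unique e r r[] r∷ fs)

-- The edge list of H ─ e is computed by a where-bound function of Defs that cannot
-- be named here; abstracting over E H lets unification find it as r above.
E-─ : ∀ {n} (H : Hypergraph n) (e : Subset n) → E (H ─ e) ≡ removeEdge e (E H)
E-─ H e with removeEdge-unique e _ refl (λ _ _ → refl) | E H
... | unique | l = unique l

degreeIn≢0 : ∀ {n} {f : Subset n} {j} (l : List (Subset n)) →
  f ∈ₗ l → lookup f j ≡ true → degreeIn l j ≢ 0
degreeIn≢0 (g ∷ l) (here refl) fj rewrite fj = λ ()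
degreeIn≢0 {j = j} (g ∷ l) (there f∈l) fj with lookup g j
... | true = λ ()
... | false = degreeIn≢0 l f∈l fj

degreeIn≡1⇒unique-edge : ∀ {n} {e f : Subset n} {j} (l : List (Subset n)) →
  degreeIn l j ≡ 1 → e ∈ₗ l → f ∈ₗ l → lookup e j ≡ true → lookup f j ≡ true → f ≡ e
degreeIn≡1⇒unique-edge (g ∷ l) d (here refl) (here refl) ej fj = refl
degreeIn≡1⇒unique-edge (g ∷ l) d (here refl) (there f∈l) ej fj rewrite ej =
  ⊥-elim (degreeIn≢0 l f∈l fj (suc-injective d))
degreeIn≡1⇒unique-edge (g ∷ l) d (there e∈l) (here refl) ej fj rewrite fj =
  ⊥-elim (degreeIn≢0 l e∈l ej (suc-injective d))
degreeIn≡1⇒unique-edge {j = j} (g ∷ l) d (there e∈l) (there f∈l) ej fj with lookup g j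
... | true = ⊥-elim (degreeIn≢0 l e∈l ej (suc-injective d))
... | false = degreeIn≡1⇒unique-edge l d e∈l f∈l ej fj

isRemovedᵇ : ∀ {n} → Hypergraph n → Subset n → Fin n → Bool
isRemovedᵇ H e j = lookup e j ∧ isCoreᵇ H j

module _ {n} (H : Hypergraph n) (e : Subset n) where

  lookup-V-─ : ∀ i → lookup (V (H ─ e)) i ≡ lookup (V H) i ∧ not (isRemovedᵇ H e i)
  lookup-V-─ = lookup∘tabulate _

  V-─⊆V : ∀ {i} → i ∈ V (H ─ e) → i ∈ V H
  V-─⊆V {i} i∈V′ = lookup⇒∈ (∧≡true⇒ˡ (trans (sym (lookup-V-─ i)) (∈⇒lookup i∈V′)))

  V-─-notRemoved : ∀ {i} → i ∈ V (H ─ e) → isRemovedᵇ H e i ≡ false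
  V-─-notRemoved {i} i∈V′ = ∧-not≡true⁻ (trans (sym (lookup-V-─ i)) (∈⇒lookup i∈V′))

  notRemoved⇒∈V-─ : ∀ {i} → i ∈ V H → isRemovedᵇ H e i ≡ false → i ∈ V (H ─ e)
  notRemoved⇒∈V-─ {i} i∈V r =
    lookup⇒∈ (trans (lookup-V-─ i) (∧-not≡true⁺ (∈⇒lookup i∈V) r))

  core⇒removed : ∀ {w} → w ∈ e → IsCore H w → isRemovedᵇ H e w ≡ true
  core⇒removed w∈e (w∈V , deg≡1) rewrite ∈⇒lookup w∈e | ∈⇒lookup w∈V | deg≡1 = refl

  removed⇒degree≡1 : ∀ {j} → isRemovedᵇ H e j ≡ true → degree H j ≡ 1
  removed⇒degree≡1 {j} r = does≡true⇒ (degree H j ≟ 1) (∧≡true⇒ʳ (∧≡true⇒ʳ {lookup e j} r))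

  removed⇒only-in-e : e ∈ₗ E H → ∀ {f j} → f ∈ₗ E H →
    isRemovedᵇ H e j ≡ true → lookup f j ≡ true → f ≡ e
  removed⇒only-in-e e∈E f∈E r fj =
    degreeIn≡1⇒unique-edge (E H) (removed⇒degree≡1 r) e∈E f∈E (∧≡true⇒ˡ r) fj

module _ {c ℓ : Level} (R : CommutativeRing c ℓ) where
  open CommutativeRing R renaming (Carrier to C; refl to ≈-refl; sym to ≈-sym; trans to ≈-trans)
  open SetoidReasoning setoid

  if-congˡ : ∀ b {p q r : C} → (b ≡ true → p ≈ q) →
    (if b then p else r) ≈ (if b then q else r)
  if-congˡ true p≈q = p≈q refl
  if-congˡ false _ = ≈-refl

  pow-zero : ∀ m → 0 < m → pow R 0# m ≈ 0#
  pow-zero (suc m) _ = zeroˡ _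

  prodFin-cong : ∀ {m} {g h : Fin m → C} → (∀ j → g j ≈ h j) → prodFin R g ≈ prodFin R h
  prodFin-cong {zero} _ = ≈-refl
  prodFin-cong {suc m} g≈h = *-cong (g≈h Fin.zero) (prodFin-cong (g≈h ∘ Fin.suc))

  prodFin-zero : ∀ {m} (g : Fin m → C) j → g j ≈ 0# → prodFin R g ≈ 0#
  prodFin-zero g Fin.zero gj≈0 = ≈-trans (*-congʳ gj≈0) (zeroˡ _)
  prodFin-zero g (Fin.suc j) gj≈0 = ≈-trans (*-congˡ (prodFin-zero (g ∘ Fin.suc) j gj≈0)) (zeroʳ _)

  module _ {n} (f : Subset n) where

    monomialWithout-cong : ∀ i {x z : Fin n → C} → (∀ j → lookup f j ≡ true → x j ≈ z j) →
      monomialWithout R f i x ≈ monomialWithout R f i z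
    monomialWithout-cong i x≈z = prodFin-cong λ j → if-congˡ _ (x≈z j ∘ ∧≡true⇒ˡ)

    monomialWithout-zero : ∀ {i w} (x : Fin n → C) → lookup f w ≡ true → w ≢ i → x w ≈ 0# →
      monomialWithout R f i x ≈ 0#
    monomialWithout-zero {i} {w} x fw w≢i xw≈0 = prodFin-zero _ w factor≈0
      where
      factor≈0 : (if lookup f w ∧ not (does (w Fin.≟ i)) then x w else 1#) ≈ 0#
      factor≈0 rewrite fw with w Fin.≟ i
      ... | yes w≡i = ⊥-elim (w≢i w≡i)
      ... | no _ = xw≈0

    edgeTerm : (Fin n → C) → Fin n → C
    edgeTerm x i = if lookup f i then monomialWithout R f i x else 0#

    edgeTerm-cong : ∀ i {x z : Fin n → C} → (∀ j → lookup f j ≡ true → x j ≈ z j) →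
      edgeTerm x i ≈ edgeTerm z i
    edgeTerm-cong i x≈z = if-congˡ (lookup f i) λ _ → monomialWithout-cong i x≈z

    edgeTerm-vanishes : ∀ {u v} (x : Fin n → C) → u ≢ v → lookup f u ≡ true → lookup f v ≡ true →
      x u ≈ 0# → x v ≈ 0# → ∀ i → edgeTerm x i ≈ 0#
    edgeTerm-vanishes {u} {v} x u≢v fu fv xu≈0 xv≈0 i with lookup f i
    ... | false = ≈-refl
    ... | true with u Fin.≟ i
    ...   | no u≢i = monomialWithout-zero x fu u≢i xu≈0
    ...   | yes refl = monomialWithout-zero x fv (u≢v ∘ sym) xv≈0

  module _ {n} (e : Subset n) (x z : Fin n → C) (i : Fin n) where

    adjApplyIn-removeEdge : ∀ l → edgeTerm e x i ≈ 0# →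
      (∀ {f} → f ∈ₗ l → f ≢ e → edgeTerm f x i ≈ edgeTerm f z i) →
      adjApplyIn R l x i ≈ adjApplyIn R (removeEdge e l) z i
    adjApplyIn-removeEdge [] _ _ = ≈-refl
    adjApplyIn-removeEdge (f ∷ fs) e≈0 kept with ≡-dec Bool._≟_ f e
    ... | yes refl = begin
      edgeTerm e x i + adjApplyIn R fs x i  ≈⟨ +-congʳ e≈0 ⟩
      0# + adjApplyIn R fs x i              ≈⟨ +-identityˡ _ ⟩
      adjApplyIn R fs x i                   ≈⟨ adjApplyIn-removeEdge fs e≈0 (kept ∘ there) ⟩
      adjApplyIn R (removeEdge e fs) z i    ∎
    ... | no f≢e = +-cong (kept (here refl) f≢e) (adjApplyIn-removeEdge fs e≈0 (kept ∘ there))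

  adjApplyIn-vanishes : ∀ {n} (x : Fin n → C) i l →
    (∀ {f} → f ∈ₗ l → edgeTerm f x i ≈ 0#) → adjApplyIn R l x i ≈ 0#
  adjApplyIn-vanishes x i [] _ = ≈-refl
  adjApplyIn-vanishes x i (f ∷ fs) terms≈0 =
    ≈-trans (+-cong (terms≈0 (here refl)) (adjApplyIn-vanishes x i fs (terms≈0 ∘ there)))
            (+-identityˡ 0#)

module Extension {c ℓ : Level} (R : CommutativeRing c ℓ) {n} (H : Hypergraph n)
  (e : Subset n) (e∈E : e ∈ₗ E H) where
  open CommutativeRing R hiding (trans) renaming (Carrier to C; refl to ≈-refl; sym to ≈-sym)
  open SetoidReasoning setoid

  extendByZero : (Fin n → C) → Fin n → C
  extendByZero y j = if isRemovedᵇ H e j then 0# else y j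

  module _ (y : Fin n → C) where

    extendByZero-removed : ∀ {j} → isRemovedᵇ H e j ≡ true → extendByZero y j ≡ 0#
    extendByZero-removed r rewrite r = refl

    extendByZero-kept : ∀ {j} → isRemovedᵇ H e j ≡ false → extendByZero y j ≡ y j
    extendByZero-kept r rewrite r = refl

    extendByZero-off-e : ∀ {f} → f ∈ₗ E H → f ≢ e →
      ∀ j → lookup f j ≡ true → extendByZero y j ≈ y j
    extendByZero-off-e f∈E f≢e j fj with isRemovedᵇ H e j in r
    ... | true = ⊥-elim (f≢e (removed⇒only-in-e H e e∈E f∈E r fj))
    ... | false = ≈-refl

    module _ {u v} (u≢v : u ≢ v) (u∈e : u ∈ e) (v∈e : v ∈ e)
      (u-core : IsCore H u) (v-core : IsCore H v) where

      edgeTerm-e : ∀ i → edgeTerm R e (extendByZero y) i ≈ 0#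
      edgeTerm-e = edgeTerm-vanishes R e (extendByZero y) u≢v (∈⇒lookup u∈e) (∈⇒lookup v∈e)
        (reflexive (extendByZero-removed (core⇒removed H e u∈e u-core)))
        (reflexive (extendByZero-removed (core⇒removed H e v∈e v-core)))

      adjApply-extendByZero : ∀ i → adjApply R H (extendByZero y) i ≈ adjApply R (H ─ e) y i
      adjApply-extendByZero i = begin
        adjApplyIn R (E H) (extendByZero y) i
          ≈⟨ adjApplyIn-removeEdge R e (extendByZero y) y i (E H) (edgeTerm-e i)
               (λ {f} f∈E f≢e → edgeTerm-cong R f i (extendByZero-off-e f∈E f≢e)) ⟩
        adjApplyIn R (removeEdge e (E H)) y i
          ≡⟨ cong (λ l → adjApplyIn R l y i) (sym (E-─ H e)) ⟩
        adjApplyIn R (E (H ─ e)) y i ∎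

      adjApply-extendByZero-removed : ∀ {i} → isRemovedᵇ H e i ≡ true →
        adjApply R H (extendByZero y) i ≈ 0#
      adjApply-extendByZero-removed {i} r = adjApplyIn-vanishes R (extendByZero y) i (E H) term≈0
        where
        term≈0 : ∀ {f} → f ∈ₗ E H → edgeTerm R f (extendByZero y) i ≈ 0#
        term≈0 {f} f∈E with ≡-dec Bool._≟_ f e
        ... | yes refl = edgeTerm-e i
        ... | no f≢e with lookup f i in fi
        ...   | false = ≈-refl
        ...   | true = ⊥-elim (f≢e (removed⇒only-in-e H e e∈E f∈E r fi))

      extendByZero-eigen : ∀ {k} → k ≥ 2 → ∀ λ' →
        (∀ i → i ∈ V (H ─ e) → adjApply R (H ─ e) y i ≈ λ' * pow R (y i) (k ∸ 1)) →
        ∀ i → i ∈ V H → adjApply R H (extendByZero y) i ≈ λ' * pow R (extendByZero y i) (k ∸ 1)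
      -- Abstracting isRemovedᵇ H e i makes extendByZero y i compute to 0# resp. y i.
      extendByZero-eigen {k} k≥2 λ' eigen′ i i∈V with isRemovedᵇ H e i in r
      ... | true = begin
        adjApply R H (extendByZero y) i  ≈⟨ adjApply-extendByZero-removed r ⟩
        0#                               ≈⟨ ≈-sym (zeroʳ λ') ⟩
        λ' * 0#                          ≈⟨ *-congˡ (≈-sym (pow-zero R (k ∸ 1) (m<n⇒0<n∸m k≥2))) ⟩
        λ' * pow R 0# (k ∸ 1)            ∎
      ... | false = begin
        adjApply R H (extendByZero y) i  ≈⟨ adjApply-extendByZero i ⟩
        adjApply R (H ─ e) y i           ≈⟨ eigen′ i (notRemoved⇒∈V-─ H e i∈V r) ⟩
        λ' * pow R (y i) (k ∸ 1)         ∎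

theorem4p1 : ∀ {c ℓ : Level} (R : CommutativeRing c ℓ) (k n : ℕ) → k ≥ 2 →
    (H : Hypergraph n) → IsUniform k H →
    (e : Subset n) → e ∈ₗ E H →
    ∃₂ (λ u v → ¬ (u ≡ v) × u ∈ e × v ∈ e × IsCore H u × IsCore H v) →
    (λ' : CommutativeRing.Carrier R) →
    IsEigenvalue R k (H ─ e) λ' → IsEigenvalue R k H λ'
theorem4p1 R k n k≥2 H _ e e∈E (u , v , u≢v , u∈e , v∈e , u-core , v-core) λ'
  (y , (i₀ , i₀∈V′ , yi₀≉0) , eigen′) =
  extendByZero y ,
  (i₀ , V-─⊆V H e i₀∈V′ , yi₀≉0 ∘ ≈-trans (reflexive (sym (extendByZero-kept y i₀-kept)))) ,
  extendByZero-eigen y u≢v u∈e v∈e u-core v-core k≥2 λ' eigen′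
  where
  open CommutativeRing R using (reflexive) renaming (trans to ≈-trans)
  open Extension R H e e∈E
  i₀-kept : isRemovedᵇ H e i₀ ≡ false
  i₀-kept = V-─-notRemoved H e i₀∈V′
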